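{- For every integer $d\ge 1$, \[ \sum_{m=1}^{d} q^{\binom{m}{2}}(1-q^m) \begin{bmatrix} 2d\\ d+m\end{bmatrix}_q=\frac{1-q^d}{1+q^d} \begin{bmatrix} 2d\\ d\end{bmatrix}_q. \]
   Context: $(a;q)_n=(1-a)(1-aq)\cdots(1-aq^{n-1})$ and $\begin{bmatrix} n\\ k\end{bmatrix}_q=\frac{(q;q)_n}{(q;q)_k(q;q)_{n-k}}$ for $n\ge k\ge 0$, and $0$ otherwise. -}

module Defs where

-- All objects in the identity (q-Pochhammer symbols, Gaussian binomials,
-- the quotient by 1+q^d) live in ℤ[[q]], where every series with constant
-- term 1 is invertible; so the paper's definitions can be taken literally.

open import Data.Nat as ℕ using (ℕ; zero; suc; _∸_; _≤ᵇ_; _≡ᵇ_)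
open import Data.Integer using (ℤ; 0ℤ; 1ℤ; _+_; _*_; -_; _-_)
open import Data.Bool using (if_then_else_)
open import Relation.Binary.PropositionalEquality using (_≡_)

Series : Set
Series = ℕ → ℤ

infix 4 _≈_
_≈_ : Series → Series → Set
f ≈ g = ∀ n → f n ≡ g n

sumBelow : (ℕ → ℤ) → ℕ → ℤ
sumBelow f zero    = 0ℤ
sumBelow f (suc n) = sumBelow f n + f n

cst : ℤ → Series
cst c zero    = c
cst c (suc n) = 0ℤ

𝟘 𝟙 : Series
𝟘 = cst 0ℤ
𝟙 = cst 1ℤ

q^ : ℕ → Series
q^ k n = if n ≡ᵇ k then 1ℤ else 0ℤ

q : Series
q = q^ 1

infixl 6 _⊕_ _⊖_
infixl 7 _⊛_
_⊕_ : Series → Series → Series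
(f ⊕ g) n = f n + g n

_⊖_ : Series → Series → Series
(f ⊖ g) n = f n - g n

_⊛_ : Series → Series → Series
(f ⊛ g) n = sumBelow (λ i → f i * g (n ∸ i)) (suc n)

-- Σ_{m=a}^{b} F m  of series
sumS : ℕ → ℕ → (ℕ → Series) → Series
sumS a b F n = sumBelow (λ j → F (a ℕ.+ j) n) (suc b ∸ a)

prodS : (ℕ → Series) → ℕ → Series
prodS F zero    = 𝟙
prodS F (suc n) = prodS F n ⊛ F n

-- Multiplicative inverse of a series f with constant term 1:
-- b_0 = 1, b_j = - Σ_{i=1}^{j} f_i b_{j-i}.
-- invUpTo f n agrees with the inverse on indices 0..n.
invUpTo : Series → ℕ → Series
invUpTo f zero    = λ _ → 1ℤ
invUpTo f (suc n) j =
  if j ≤ᵇ n then invUpTo f n j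
  else - sumBelow (λ i → f (suc i) * invUpTo f n (j ∸ suc i)) j

inv : Series → Series
inv f n = invUpTo f n n

poch : Series → ℕ → Series
poch a n = prodS (λ i → 𝟙 ⊖ a ⊛ q^ i) n

qbinom : ℕ → ℕ → Series
qbinom n k = if k ≤ᵇ n
  then poch q n ⊛ inv (poch q k) ⊛ inv (poch q (n ∸ k))
  else 𝟘

module Submission where

-- Put T(m) = q^(m choose 2) (1 - q^(d+m)) [2d, d+m].  Writing q^d = q^m q^(d-m)
-- and using the ratio of consecutive Gaussian binomials
--   (1 - q^(k+1)) [n, k+1] = (1 - q^(n-k)) [n, k],
-- each summand, multiplied by 1 + q^d, becomes T(m) - T(m+1).  The sum therefore
-- telescopes to T(1) - T(d+1) = (1 - q^d) [2d, d] - 0, and dividing by 1 + q^d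
-- (whose constant term is 1) gives the claim.

open import Defs

module FiniteSums where

  open import Data.Nat using (ℕ; zero; suc; _∸_; _<_)
  import Data.Nat as ℕ
  import Data.Nat.Properties as ℕₚ
  open import Data.Integer using (ℤ; 0ℤ; _+_; _*_; _-_)
  import Data.Integer.Properties as ℤₚ
  open import Algebra.Properties.CommutativeSemigroup ℤₚ.+-commutativeSemigroup
    using (interchange)
  open import Relation.Binary.PropositionalEquality
  open ≡-Reasoning

  sum-cong : ∀ {f g : ℕ → ℤ} n → (∀ i → i < n → f i ≡ g i) →
             sumBelow f n ≡ sumBelow g n
  sum-cong zero    f≡g = refl
  sum-cong (suc n) f≡g =
    cong₂ _+_ (sum-cong n (λ i i<n → f≡g i (ℕₚ.m<n⇒m<1+n i<n))) (f≡g n ℕₚ.≤-refl)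

  sum-+ : ∀ (f g : ℕ → ℤ) n →
          sumBelow (λ i → f i + g i) n ≡ sumBelow f n + sumBelow g n
  sum-+ f g zero    = refl
  sum-+ f g (suc n) = trans (cong (_+ (f n + g n)) (sum-+ f g n))
                            (interchange (sumBelow f n) (sumBelow g n) (f n) (g n))

  sum-*ˡ : ∀ c (f : ℕ → ℤ) n → c * sumBelow f n ≡ sumBelow (λ i → c * f i) n
  sum-*ˡ c f zero    = ℤₚ.*-zeroʳ c
  sum-*ˡ c f (suc n) = trans (ℤₚ.*-distribˡ-+ c (sumBelow f n) (f n))
                             (cong (_+ c * f n) (sum-*ˡ c f n))

  sum-*ʳ : ∀ c (f : ℕ → ℤ) n → sumBelow f n * c ≡ sumBelow (λ i → f i * c) n
  sum-*ʳ c f n = begin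
    sumBelow f n * c                ≡⟨ ℤₚ.*-comm (sumBelow f n) c ⟩
    c * sumBelow f n                ≡⟨ sum-*ˡ c f n ⟩
    sumBelow (λ i → c * f i) n      ≡⟨ sum-cong n (λ i _ → ℤₚ.*-comm c (f i)) ⟩
    sumBelow (λ i → f i * c) n      ∎

  sum-zero : ∀ n → sumBelow (λ _ → 0ℤ) n ≡ 0ℤ
  sum-zero zero    = refl
  sum-zero (suc n) = cong (_+ 0ℤ) (sum-zero n)

  sum-first : ∀ (f : ℕ → ℤ) n →
              sumBelow f (suc n) ≡ f 0 + sumBelow (λ i → f (suc i)) n
  sum-first f zero    = trans (ℤₚ.+-identityˡ (f 0)) (sym (ℤₚ.+-identityʳ (f 0)))
  sum-first f (suc n) = trans (cong (_+ f (suc n)) (sum-first f n))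
                              (ℤₚ.+-assoc (f 0) _ _)

  sum-reverse : ∀ (f : ℕ → ℤ) n →
                sumBelow f n ≡ sumBelow (λ i → f (n ∸ suc i)) n
  sum-reverse f zero    = refl
  sum-reverse f (suc n) = begin
    sumBelow f n + f n
      ≡⟨ cong (_+ f n) (sum-reverse f n) ⟩
    sumBelow (λ i → f (n ∸ suc i)) n + f n
      ≡⟨ ℤₚ.+-comm _ (f n) ⟩
    f n + sumBelow (λ i → f (n ∸ suc i)) n
      ≡⟨ sym (sum-first (λ i → f (suc n ∸ suc i)) n) ⟩
    sumBelow (λ i → f (suc n ∸ suc i)) (suc n) ∎

  sum-triangle : ∀ (F : ℕ → ℕ → ℤ) N →
    sumBelow (λ i → sumBelow (λ j → F j i) (suc i)) N ≡
    sumBelow (λ j → sumBelow (λ k → F j (j ℕ.+ k)) (N ∸ j)) N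
  sum-triangle F zero    = refl
  sum-triangle F (suc N) = begin
    inner N + sumBelow (λ j → F j N) (suc N)
      ≡⟨ cong (_+ sumBelow (λ j → F j N) (suc N)) (sum-triangle F N) ⟩
    sumBelow (row N) N + sumBelow (λ j → F j N) (suc N)
      ≡⟨ cong₂ _+_ (sym last-row-empty) (sum-cong (suc N) diagonal) ⟩
    sumBelow (row N) (suc N) + sumBelow (λ j → F j (j ℕ.+ (N ∸ j))) (suc N)
      ≡⟨ sym (sum-+ (row N) _ (suc N)) ⟩
    sumBelow (λ j → sumBelow (λ k → F j (j ℕ.+ k)) (suc (N ∸ j))) (suc N)
      ≡⟨ sum-cong (suc N) (λ j j≤N → cong (sumBelow (λ k → F j (j ℕ.+ k)))
                                          (sym (ℕₚ.+-∸-assoc 1 (ℕₚ.≤-pred j≤N)))) ⟩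
    sumBelow (row (suc N)) (suc N) ∎
    where
    inner : ℕ → ℤ
    inner M = sumBelow (λ i → sumBelow (λ j → F j i) (suc i)) M
    row : ℕ → ℕ → ℤ
    row M j = sumBelow (λ k → F j (j ℕ.+ k)) (M ∸ j)
    last-row-empty : sumBelow (row N) (suc N) ≡ sumBelow (row N) N
    last-row-empty = trans (cong (λ x → sumBelow (row N) N + sumBelow (λ k → F N (N ℕ.+ k)) x)
                                 (ℕₚ.n∸n≡0 N))
                           (ℤₚ.+-identityʳ _)
    diagonal : ∀ j → j < suc N → F j N ≡ F j (j ℕ.+ (N ∸ j))
    diagonal j j≤N = cong (F j) (sym (ℕₚ.m+[n∸m]≡n (ℕₚ.≤-pred j≤N)))

  sum-telescope : ∀ (u : ℕ → ℤ) k →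
                  sumBelow (λ j → u j - u (suc j)) k ≡ u 0 - u k
  sum-telescope u zero    = sym (ℤₚ.+-inverseʳ (u 0))
  sum-telescope u (suc k) = trans (cong (_+ (u k - u (suc k))) (sum-telescope u k))
                                  (ℤₚ.+-minus-telescope (u 0) (u k) (u (suc k)))

module SeriesRing where

  open FiniteSums
  open import Data.Nat using (zero; suc; _∸_)
  import Data.Nat as ℕ
  import Data.Nat.Properties as ℕₚ
  open import Data.Integer using (0ℤ; 1ℤ; _+_; _*_; -_)
  import Data.Integer.Properties as ℤₚ
  open import Data.Product using (_,_)
  open import Level using (0ℓ)
  open import Algebra.Bundles using (CommutativeRing)
  open import Relation.Binary.PropositionalEquality
  open ≡-Reasoning

  ⊝_ : Series → Series
  (⊝ f) n = - f n

  𝟘-coeff : ∀ n → 𝟘 n ≡ 0ℤ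
  𝟘-coeff zero    = refl
  𝟘-coeff (suc n) = refl

  ⊛-cong : ∀ {f f′ g g′} → f ≈ f′ → g ≈ g′ → f ⊛ g ≈ f′ ⊛ g′
  ⊛-cong f≈f′ g≈g′ n = sum-cong (suc n) (λ i _ → cong₂ _*_ (f≈f′ i) (g≈g′ (n ∸ i)))

  ⊛-comm : ∀ f g → f ⊛ g ≈ g ⊛ f
  ⊛-comm f g n = trans (sum-reverse _ (suc n)) (sum-cong (suc n) reflect)
    where
    reflect : ∀ i → i ℕ.< suc n → f (n ∸ i) * g (n ∸ (n ∸ i)) ≡ g i * f (n ∸ i)
    reflect i i≤n = trans (cong (λ j → f (n ∸ i) * g j) (ℕₚ.m∸[m∸n]≡n (ℕₚ.≤-pred i≤n)))
                          (ℤₚ.*-comm (f (n ∸ i)) (g i))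

  ⊛-assoc : ∀ f g h → (f ⊛ g) ⊛ h ≈ f ⊛ (g ⊛ h)
  ⊛-assoc f g h n = begin
    sumBelow (λ i → sumBelow (λ j → f j * g (i ∸ j)) (suc i) * h (n ∸ i)) (suc n)
      ≡⟨ sum-cong (suc n) (λ i _ → sum-*ʳ (h (n ∸ i)) (λ j → f j * g (i ∸ j)) (suc i)) ⟩
    sumBelow (λ i → sumBelow (λ j → f j * g (i ∸ j) * h (n ∸ i)) (suc i)) (suc n)
      ≡⟨ sum-triangle (λ j i → f j * g (i ∸ j) * h (n ∸ i)) (suc n) ⟩
    sumBelow (λ j → sumBelow (λ k → f j * g (j ℕ.+ k ∸ j) * h (n ∸ (j ℕ.+ k))) (suc n ∸ j)) (suc n)
      ≡⟨ sum-cong (suc n) regroup ⟩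
    sumBelow (λ j → f j * sumBelow (λ k → g k * h (n ∸ j ∸ k)) (suc (n ∸ j))) (suc n) ∎
    where
    regroup : ∀ j → j ℕ.< suc n →
      sumBelow (λ k → f j * g (j ℕ.+ k ∸ j) * h (n ∸ (j ℕ.+ k))) (suc n ∸ j) ≡
      f j * sumBelow (λ k → g k * h (n ∸ j ∸ k)) (suc (n ∸ j))
    regroup j j≤n = begin
      sumBelow (λ k → f j * g (j ℕ.+ k ∸ j) * h (n ∸ (j ℕ.+ k))) (suc n ∸ j)
        ≡⟨ cong (sumBelow _) (ℕₚ.+-∸-assoc 1 (ℕₚ.≤-pred j≤n)) ⟩
      sumBelow (λ k → f j * g (j ℕ.+ k ∸ j) * h (n ∸ (j ℕ.+ k))) (suc (n ∸ j))
        ≡⟨ sum-cong (suc (n ∸ j)) (λ k _ →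
             trans (cong₂ (λ a b → f j * g a * h b) (ℕₚ.m+n∸m≡n j k) (sym (ℕₚ.∸-+-assoc n j k)))
                   (ℤₚ.*-assoc (f j) (g k) (h (n ∸ j ∸ k)))) ⟩
      sumBelow (λ k → f j * (g k * h (n ∸ j ∸ k))) (suc (n ∸ j))
        ≡⟨ sym (sum-*ˡ (f j) (λ k → g k * h (n ∸ j ∸ k)) (suc (n ∸ j))) ⟩
      f j * sumBelow (λ k → g k * h (n ∸ j ∸ k)) (suc (n ∸ j)) ∎

  ⊛-distribˡ : ∀ f g h → f ⊛ (g ⊕ h) ≈ f ⊛ g ⊕ f ⊛ h
  ⊛-distribˡ f g h n =
    trans (sum-cong (suc n) (λ i _ → ℤₚ.*-distribˡ-+ (f i) (g (n ∸ i)) (h (n ∸ i))))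
          (sum-+ _ _ (suc n))

  ⊛-identityˡ : ∀ f → 𝟙 ⊛ f ≈ f
  ⊛-identityˡ f n = begin
    sumBelow (λ i → 𝟙 i * f (n ∸ i)) (suc n)
      ≡⟨ sum-first _ n ⟩
    1ℤ * f n + sumBelow (λ i → 0ℤ * f (n ∸ suc i)) n
      ≡⟨ cong₂ _+_ (ℤₚ.*-identityˡ (f n))
                   (trans (sum-cong n (λ i _ → ℤₚ.*-zeroˡ (f (n ∸ suc i)))) (sum-zero n)) ⟩
    f n + 0ℤ
      ≡⟨ ℤₚ.+-identityʳ (f n) ⟩
    f n ∎

  -- Coefficientwise equality, wrapped in a record: unlike _≈_ it is not unfolded
  -- during unification, so the implicit arguments of the ring laws stay inferable.
  record _≋_ (f g : Series) : Set where
    constructor coeffwise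
    field coeffs : f ≈ g
  open _≋_ public

  infix 4 _≋_

  ≡⇒≋ : ∀ {f g} → f ≡ g → f ≋ g
  ≡⇒≋ refl = coeffwise (λ _ → refl)

  seriesRing : CommutativeRing 0ℓ 0ℓ
  seriesRing = record
    { Carrier = Series ; _≈_ = _≋_ ; _+_ = _⊕_ ; _*_ = _⊛_ ; -_ = ⊝_ ; 0# = 𝟘 ; 1# = 𝟙
    ; isCommutativeRing = record
      { isRing = record
        { +-isAbelianGroup = record
          { isGroup = record
            { isMonoid = record
              { isSemigroup = record
                { isMagma = record
                  { isEquivalence = record
                    { refl  = coeffwise (λ n → refl)
                    ; sym   = λ p → coeffwise (λ n → sym (coeffs p n))
                    ; trans = λ p r → coeffwise (λ n → trans (coeffs p n) (coeffs r n)) }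
                  ; ∙-cong = λ p r → coeffwise (λ n → cong₂ _+_ (coeffs p n) (coeffs r n)) }
                ; assoc = λ f g h → coeffwise (λ n → ℤₚ.+-assoc (f n) (g n) (h n)) }
              ; identity =
                  (λ f → coeffwise (λ n → trans (cong (_+ f n) (𝟘-coeff n)) (ℤₚ.+-identityˡ (f n))))
                , (λ f → coeffwise (λ n → trans (cong (f n +_) (𝟘-coeff n)) (ℤₚ.+-identityʳ (f n)))) }
            ; inverse = (λ f → coeffwise (λ n → trans (ℤₚ.+-inverseˡ (f n)) (sym (𝟘-coeff n))))
                      , (λ f → coeffwise (λ n → trans (ℤₚ.+-inverseʳ (f n)) (sym (𝟘-coeff n))))
            ; ⁻¹-cong = λ p → coeffwise (λ n → cong -_ (coeffs p n)) }
          ; comm = λ f g → coeffwise (λ n → ℤₚ.+-comm (f n) (g n)) }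
        ; *-cong = λ p r → coeffwise (⊛-cong (coeffs p) (coeffs r))
        ; *-assoc = λ f g h → coeffwise (⊛-assoc f g h)
        ; *-identity = (λ f → coeffwise (⊛-identityˡ f))
                     , (λ f → coeffwise (λ n → trans (⊛-comm f 𝟙 n) (⊛-identityˡ f n)))
        ; distrib = (λ f g h → coeffwise (⊛-distribˡ f g h))
                  , (λ f g h → coeffwise (λ n → trans (⊛-comm (g ⊕ h) f n)
                                       (trans (⊛-distribˡ f g h n)
                                              (cong₂ _+_ (⊛-comm f g n) (⊛-comm f h n))))) }
      ; *-comm = λ f g → coeffwise (⊛-comm f g) } }

module SeriesSolver where

  open SeriesRing
  open FiniteSums
  open import Data.Nat using (zero; suc; _∸_)
  open import Data.Integer using (0ℤ; _+_; _*_; -_)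
  import Data.Integer.Properties as ℤₚ
  open import Data.Maybe using (Maybe; just; nothing)
  open import Relation.Nullary using (yes; no)
  open import Algebra.Bundles using (CommutativeRing)
  open import Algebra.Solver.Ring.AlmostCommutativeRing
    using (fromCommutativeRing; _-Raw-AlmostCommutative⟶_)
  open import Relation.Binary.PropositionalEquality

  cst-+ : ∀ a b → cst (a + b) ≈ cst a ⊕ cst b
  cst-+ a b zero    = refl
  cst-+ a b (suc n) = refl

  cst-* : ∀ a b → cst (a * b) ≈ cst a ⊛ cst b
  cst-* a b zero    = sym (ℤₚ.+-identityˡ _)
  cst-* a b (suc n) = sym (begin
    sumBelow (λ i → cst a i * cst b (suc n ∸ i)) (suc (suc n))
      ≡⟨ sum-first _ (suc n) ⟩
    a * 0ℤ + sumBelow (λ i → 0ℤ * cst b (n ∸ i)) (suc n)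
      ≡⟨ cong₂ _+_ (ℤₚ.*-zeroʳ a)
                   (trans (sum-cong (suc n) (λ i _ → ℤₚ.*-zeroˡ (cst b (n ∸ i)))) (sum-zero (suc n))) ⟩
    0ℤ ∎)
    where open ≡-Reasoning

  cst-neg : ∀ a → cst (- a) ≈ ⊝ cst a
  cst-neg a zero    = refl
  cst-neg a (suc n) = refl

  constants : CommutativeRing.rawRing ℤₚ.+-*-commutativeRing
                -Raw-AlmostCommutative⟶ fromCommutativeRing seriesRing
  constants = record { ⟦_⟧ = cst
                     ; +-homo = λ a b → coeffwise (cst-+ a b)
                     ; *-homo = λ a b → coeffwise (cst-* a b)
                     ; -‿homo = λ a → coeffwise (cst-neg a)
                     ; 0-homo = coeffwise (λ _ → refl) ; 1-homo = coeffwise (λ _ → refl) }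

  equal-constants? : ∀ a b → Maybe (cst a ≋ cst b)
  equal-constants? a b with a ℤₚ.≟ b
  ... | yes refl = just (coeffwise (λ _ → refl))
  ... | no  _    = nothing

  open import Algebra.Solver.Ring _ _ constants equal-constants? public

module Conditionals where

  open import Data.Bool using (true; false; T; if_then_else_)
  open import Data.Unit using (tt)
  open import Data.Empty using (⊥-elim)
  open import Relation.Nullary using (¬_)
  open import Relation.Binary.PropositionalEquality using (_≡_; refl)

  if-true : ∀ {A : Set} {b} {x y : A} → T b → (if b then x else y) ≡ x
  if-true {b = true} _ = refl

  if-false : ∀ {A : Set} {b} {x y : A} → ¬ T b → (if b then x else y) ≡ y
  if-false {b = true}  ¬t = ⊥-elim (¬t tt)
  if-false {b = false} _  = refl

module Monomials where

  open FiniteSums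
  open SeriesRing
  open Conditionals
  open import Data.Nat using (ℕ; zero; suc; _∸_; _≤_; _<_; s≤s)
  import Data.Nat as ℕ
  import Data.Nat.Properties as ℕₚ
  open import Data.Integer using (ℤ; 0ℤ; 1ℤ; _+_; _*_)
  import Data.Integer.Properties as ℤₚ
  open import Relation.Nullary using (yes; no)
  open import Data.Sum using (inj₁; inj₂)
  open import Relation.Binary.PropositionalEquality
  open ≡-Reasoning

  q^-coeff-same : ∀ a → q^ a a ≡ 1ℤ
  q^-coeff-same a = if-true (ℕₚ.≡⇒≡ᵇ a a refl)

  q^-coeff-other : ∀ a i → i ≢ a → q^ a i ≡ 0ℤ
  q^-coeff-other a i i≢a = if-false (λ t → i≢a (ℕₚ.≡ᵇ⇒≡ i a t))

  q^-zero : q^ 0 ≋ 𝟙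
  q^-zero = coeffwise λ { zero → refl ; (suc n) → refl }

  q^-select-absent : ∀ a (h : ℕ → ℤ) N → N ≤ a → sumBelow (λ i → q^ a i * h i) N ≡ 0ℤ
  q^-select-absent a h zero    _   = refl
  q^-select-absent a h (suc N) N<a = begin
    sumBelow (λ i → q^ a i * h i) N + q^ a N * h N
      ≡⟨ cong₂ _+_ (q^-select-absent a h N (ℕₚ.<⇒≤ N<a))
                   (cong (_* h N) (q^-coeff-other a N (ℕₚ.<⇒≢ N<a))) ⟩
    0ℤ + 0ℤ * h N
      ≡⟨ cong (0ℤ +_) (ℤₚ.*-zeroˡ (h N)) ⟩
    0ℤ ∎

  q^-select : ∀ a (h : ℕ → ℤ) N → a < N → sumBelow (λ i → q^ a i * h i) N ≡ h a
  q^-select a h (suc N) a<1+N with ℕₚ.m≤n⇒m<n∨m≡n (ℕₚ.≤-pred a<1+N)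
  ... | inj₁ a<N = begin
    sumBelow (λ i → q^ a i * h i) N + q^ a N * h N
      ≡⟨ cong₂ _+_ (q^-select a h N a<N)
                   (cong (_* h N) (q^-coeff-other a N (≢-sym (ℕₚ.<⇒≢ a<N)))) ⟩
    h a + 0ℤ * h N
      ≡⟨ trans (cong (h a +_) (ℤₚ.*-zeroˡ (h N))) (ℤₚ.+-identityʳ (h a)) ⟩
    h a ∎
  ... | inj₂ refl = begin
    sumBelow (λ i → q^ a i * h i) a + q^ a a * h a
      ≡⟨ cong₂ _+_ (q^-select-absent a h a ℕₚ.≤-refl) (cong (_* h a) (q^-coeff-same a)) ⟩
    0ℤ + 1ℤ * h a
      ≡⟨ trans (ℤₚ.+-identityˡ _) (ℤₚ.*-identityˡ (h a)) ⟩
    h a ∎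

  q^-shift : ∀ a g n → a ≤ n → (q^ a ⊛ g) n ≡ g (n ∸ a)
  q^-shift a g n a≤n = q^-select a (λ i → g (n ∸ i)) (suc n) (s≤s a≤n)

  q^-shift-low : ∀ a g n → n < a → (q^ a ⊛ g) n ≡ 0ℤ
  q^-shift-low a g n n<a = q^-select-absent a (λ i → g (n ∸ i)) (suc n) n<a

  q^-+-coeffs : ∀ a b → q^ a ⊛ q^ b ≈ q^ (a ℕ.+ b)
  q^-+-coeffs a b n with a ℕ.≤? n
  ... | no a≰n = begin
    (q^ a ⊛ q^ b) n      ≡⟨ q^-shift-low a (q^ b) n (ℕₚ.≰⇒> a≰n) ⟩
    0ℤ                   ≡⟨ sym (q^-coeff-other (a ℕ.+ b) n n≢a+b) ⟩
    q^ (a ℕ.+ b) n       ∎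
    where
    n≢a+b : n ≢ a ℕ.+ b
    n≢a+b n≡a+b = a≰n (ℕₚ.m+n≤o⇒m≤o a (ℕₚ.≤-reflexive (sym n≡a+b)))
  ... | yes a≤n with n ℕₚ.≟ a ℕ.+ b
  ...   | yes refl = begin
    (q^ a ⊛ q^ b) n      ≡⟨ q^-shift a (q^ b) n a≤n ⟩
    q^ b (a ℕ.+ b ∸ a)   ≡⟨ cong (q^ b) (ℕₚ.m+n∸m≡n a b) ⟩
    q^ b b               ≡⟨ trans (q^-coeff-same b) (sym (q^-coeff-same (a ℕ.+ b))) ⟩
    q^ (a ℕ.+ b) n       ∎
  ...   | no n≢a+b = begin
    (q^ a ⊛ q^ b) n      ≡⟨ q^-shift a (q^ b) n a≤n ⟩
    q^ b (n ∸ a)         ≡⟨ q^-coeff-other b (n ∸ a) n∸a≢b ⟩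
    0ℤ                   ≡⟨ sym (q^-coeff-other (a ℕ.+ b) n n≢a+b) ⟩
    q^ (a ℕ.+ b) n       ∎
    where
    n∸a≢b : n ∸ a ≢ b
    n∸a≢b n∸a≡b = n≢a+b (trans (sym (ℕₚ.m+[n∸m]≡n a≤n)) (cong (a ℕ.+_) n∸a≡b))

  q^-+ : ∀ a b → q^ a ⊛ q^ b ≋ q^ (a ℕ.+ b)
  q^-+ a b = coeffwise (q^-+-coeffs a b)

module Inverses where

  open FiniteSums
  open SeriesRing
  open Conditionals
  open import Data.Nat using (zero; suc; _∸_; _≤_; z≤n)
  import Data.Nat.Properties as ℕₚ
  open import Data.Integer using (ℤ; 0ℤ; 1ℤ; _+_; _*_; -_)
  import Data.Integer.Properties as ℤₚ
  open import Data.Sum using (inj₁; inj₂)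
  open import Relation.Binary.PropositionalEquality

  ConstantTermOne : Series → Set
  ConstantTermOne f = f 0 ≡ 1ℤ

  ⊛-constant-term : ∀ f g → (f ⊛ g) 0 ≡ f 0 * g 0
  ⊛-constant-term f g = ℤₚ.+-identityˡ _

  ⊛-constantTermOne : ∀ f g → ConstantTermOne f → ConstantTermOne g → ConstantTermOne (f ⊛ g)
  ⊛-constantTermOne f g f0 g0 = trans (⊛-constant-term f g) (cong₂ _*_ f0 g0)

  invUpTo-stable : ∀ f {j} n → j ≤ n → invUpTo f n j ≡ inv f j
  invUpTo-stable f zero    z≤n  = refl
  invUpTo-stable f (suc n) j≤1+n with ℕₚ.m≤n⇒m<n∨m≡n j≤1+n
  ... | inj₁ j≤n  = trans (if-true (ℕₚ.≤⇒≤ᵇ (ℕₚ.≤-pred j≤n)))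
                          (invUpTo-stable f n (ℕₚ.≤-pred j≤n))
  ... | inj₂ refl = refl

  inv-suc : ∀ f n → inv f (suc n) ≡ - sumBelow (λ i → f (suc i) * inv f (n ∸ i)) (suc n)
  inv-suc f n = trans (if-false (λ t → ℕₚ.<-irrefl refl (ℕₚ.≤ᵇ⇒≤ (suc n) n t)))
    (cong -_ (sum-cong (suc n) (λ i _ → cong (f (suc i) *_) (invUpTo-stable f n (ℕₚ.m∸n≤m n i)))))

  -- f · inv f = 1: the recursion for inv f is exactly the vanishing of the higher coefficients
  inv-inverse-coeffs : ∀ f → ConstantTermOne f → f ⊛ inv f ≈ 𝟙
  inv-inverse-coeffs f f0 zero    = cong (λ c → 0ℤ + c * 1ℤ) f0
  inv-inverse-coeffs f f0 (suc n) = begin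
    sumBelow (λ i → f i * inv f (suc n ∸ i)) (suc (suc n)) ≡⟨ sum-first _ (suc n) ⟩
    f 0 * inv f (suc n) + X                               ≡⟨ cong (λ z → f 0 * z + X) (inv-suc f n) ⟩
    f 0 * (- X) + X                                       ≡⟨ cong (λ c → c * (- X) + X) f0 ⟩
    1ℤ * (- X) + X                                        ≡⟨ cong (_+ X) (ℤₚ.*-identityˡ (- X)) ⟩
    - X + X                                               ≡⟨ ℤₚ.+-inverseˡ X ⟩
    0ℤ                                                    ∎
    where
    open ≡-Reasoning
    X : ℤ
    X = sumBelow (λ i → f (suc i) * inv f (n ∸ i)) (suc n)

  inv-inverse : ∀ f → ConstantTermOne f → f ⊛ inv f ≋ 𝟙
  inv-inverse f f0 = coeffwise (inv-inverse-coeffs f f0)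

module Division where

  open SeriesRing
  open Inverses
  open import Algebra.Bundles using (CommutativeRing)
  open CommutativeRing seriesRing
    using (setoid; refl; sym; trans; *-cong; *-comm; *-assoc; *-congˡ; *-congʳ; *-identityˡ; *-identityʳ)
  open import Relation.Binary.Reasoning.Setoid setoid

  divide : ∀ f {a b} → ConstantTermOne f → f ⊛ a ≋ b → a ≋ inv f ⊛ b
  divide f {a} {b} f0 fa≋b = begin
    a                   ≈⟨ *-identityˡ a ⟨
    𝟙 ⊛ a               ≈⟨ *-congʳ {a} (trans (*-comm (inv f) f) (inv-inverse f f0)) ⟨
    (inv f ⊛ f) ⊛ a     ≈⟨ *-assoc (inv f) f a ⟩
    inv f ⊛ (f ⊛ a)     ≈⟨ *-congˡ {inv f} fa≋b ⟩
    inv f ⊛ b           ∎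

  inv-unique : ∀ f {h} → ConstantTermOne f → f ⊛ h ≋ 𝟙 → h ≋ inv f
  inv-unique f {h} f0 fh≋1 = trans (divide f f0 fh≋1) (*-identityʳ (inv f))

  inv-⊛ : ∀ f g → ConstantTermOne f → ConstantTermOne g → inv (f ⊛ g) ≋ inv f ⊛ inv g
  inv-⊛ f g f0 g0 = sym (inv-unique (f ⊛ g) (⊛-constantTermOne f g f0 g0) (begin
    (f ⊛ g) ⊛ (inv f ⊛ inv g)
      ≈⟨ solve 4 (λ f g f′ g′ → (f :* g) :* (f′ :* g′) := (f :* f′) :* (g :* g′)) refl
               f g (inv f) (inv g) ⟩
    (f ⊛ inv f) ⊛ (g ⊛ inv g)
      ≈⟨ *-cong (inv-inverse f f0) (inv-inverse g g0) ⟩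
    𝟙 ⊛ 𝟙
      ≈⟨ *-identityˡ 𝟙 ⟩
    𝟙 ∎))
    where open SeriesSolver

module GaussianBinomials where

  open SeriesRing
  open Conditionals
  open Monomials
  open Inverses
  open Division
  open import Data.Nat using (ℕ; zero; suc; _∸_; _≤_; _<_)
  import Data.Nat.Properties as ℕₚ
  open import Data.Sum using (inj₁; inj₂)
  open import Algebra.Bundles using (CommutativeRing)
  open CommutativeRing seriesRing
    using (setoid; refl; sym; trans; *-cong; *-congˡ; *-congʳ; *-identityˡ; zeroˡ; zeroʳ;
           +-congˡ; -‿cong; -‿inverseʳ)
  open import Relation.Binary.Reasoning.Setoid setoid
  import Relation.Binary.PropositionalEquality as ≡

  P : ℕ → Series
  P k = poch q k

  P⁻¹ : ℕ → Series
  P⁻¹ k = inv (P k)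

  factor-constantTermOne : ∀ k → ConstantTermOne (𝟙 ⊖ q ⊛ q^ k)
  factor-constantTermOne k = ≡.refl

  poch-constantTermOne : ∀ k → ConstantTermOne (P k)
  poch-constantTermOne zero    = ≡.refl
  poch-constantTermOne (suc k) =
    ⊛-constantTermOne (P k) (𝟙 ⊖ q ⊛ q^ k) (poch-constantTermOne k) (factor-constantTermOne k)

  qbinom-unfold : ∀ n k → k ≤ n → qbinom n k ≋ P n ⊛ P⁻¹ k ⊛ P⁻¹ (n ∸ k)
  qbinom-unfold n k k≤n = ≡⇒≋ (if-true (ℕₚ.≤⇒≤ᵇ k≤n))

  qbinom-vanish : ∀ n k → n < k → qbinom n k ≋ 𝟘
  qbinom-vanish n k n<k = ≡⇒≋ (if-false (λ t → ℕₚ.<⇒≱ n<k (ℕₚ.≤ᵇ⇒≤ k n t)))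

  cancel-last-factor : ∀ a → (𝟙 ⊖ q^ (suc a)) ⊛ P⁻¹ (suc a) ≋ P⁻¹ a
  cancel-last-factor a = begin
    (𝟙 ⊖ q^ (suc a)) ⊛ P⁻¹ (suc a)
      ≈⟨ *-cong (sym (+-congˡ {𝟙} (-‿cong (q^-+ 1 a))))
                (inv-⊛ (P a) e (poch-constantTermOne a) (factor-constantTermOne a)) ⟩
    e ⊛ (P⁻¹ a ⊛ inv e)
      ≈⟨ solve 3 (λ e i j → e :* (i :* j) := (e :* j) :* i) refl e (P⁻¹ a) (inv e) ⟩
    (e ⊛ inv e) ⊛ P⁻¹ a
      ≈⟨ *-congʳ {P⁻¹ a} (inv-inverse e (factor-constantTermOne a)) ⟩
    𝟙 ⊛ P⁻¹ a
      ≈⟨ *-identityˡ (P⁻¹ a) ⟩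
    P⁻¹ a ∎
    where
    open SeriesSolver
    e : Series
    e = 𝟙 ⊖ q ⊛ q^ a

  qbinom-ratio : ∀ n k → k ≤ n →
                 (𝟙 ⊖ q^ (suc k)) ⊛ qbinom n (suc k) ≋ (𝟙 ⊖ q^ (n ∸ k)) ⊛ qbinom n k
  qbinom-ratio n k k≤n with ℕₚ.m≤n⇒m<n∨m≡n k≤n
  ... | inj₂ ≡.refl = begin
    (𝟙 ⊖ q^ (suc n)) ⊛ qbinom n (suc n)
                                          ≈⟨ *-congˡ {𝟙 ⊖ q^ (suc n)} (qbinom-vanish n (suc n) ℕₚ.≤-refl) ⟩
    (𝟙 ⊖ q^ (suc n)) ⊛ 𝟘                  ≈⟨ zeroʳ (𝟙 ⊖ q^ (suc n)) ⟩
    𝟘                                     ≈⟨ zeroˡ (qbinom n n) ⟨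
    𝟘 ⊛ qbinom n n                        ≈⟨ *-congʳ {qbinom n n} one-minus-one ⟨
    (𝟙 ⊖ q^ (n ∸ n)) ⊛ qbinom n n         ∎
    where
    one-minus-one : 𝟙 ⊖ q^ (n ∸ n) ≋ 𝟘
    one-minus-one = trans (+-congˡ {𝟙} (-‿cong (trans (≡⇒≋ (≡.cong q^ (ℕₚ.n∸n≡0 n))) q^-zero)))
                          (-‿inverseʳ 𝟙)
  ... | inj₁ k<n = begin
    (𝟙 ⊖ q^ (suc k)) ⊛ qbinom n (suc k)
      ≈⟨ *-congˡ {𝟙 ⊖ q^ (suc k)} (qbinom-unfold n (suc k) k<n) ⟩
    (𝟙 ⊖ q^ (suc k)) ⊛ (P n ⊛ P⁻¹ (suc k) ⊛ P⁻¹ b)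
      ≈⟨ solve 4 (λ x p i j → x :* (p :* i :* j) := p :* (x :* i) :* j) refl
                 (𝟙 ⊖ q^ (suc k)) (P n) (P⁻¹ (suc k)) (P⁻¹ b) ⟩
    P n ⊛ ((𝟙 ⊖ q^ (suc k)) ⊛ P⁻¹ (suc k)) ⊛ P⁻¹ b
      ≈⟨ *-congʳ {P⁻¹ b} (*-congˡ {P n} (cancel-last-factor k)) ⟩
    P n ⊛ P⁻¹ k ⊛ P⁻¹ b
      ≈⟨ *-congˡ {P n ⊛ P⁻¹ k} (cancel-last-factor b) ⟨
    P n ⊛ P⁻¹ k ⊛ ((𝟙 ⊖ q^ (suc b)) ⊛ P⁻¹ (suc b))
      ≈⟨ solve 4 (λ x p i j → p :* i :* (x :* j) := x :* (p :* i :* j)) refl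
                 (𝟙 ⊖ q^ (suc b)) (P n) (P⁻¹ k) (P⁻¹ (suc b)) ⟩
    (𝟙 ⊖ q^ (suc b)) ⊛ (P n ⊛ P⁻¹ k ⊛ P⁻¹ (suc b))
      ≈⟨ ≡⇒≋ (≡.cong (λ c → (𝟙 ⊖ q^ c) ⊛ (P n ⊛ P⁻¹ k ⊛ P⁻¹ c)) n∸k≡1+b) ⟨
    (𝟙 ⊖ q^ (n ∸ k)) ⊛ (P n ⊛ P⁻¹ k ⊛ P⁻¹ (n ∸ k))
      ≈⟨ *-congˡ {𝟙 ⊖ q^ (n ∸ k)} (qbinom-unfold n k k≤n) ⟨
    (𝟙 ⊖ q^ (n ∸ k)) ⊛ qbinom n k ∎
    where
    open SeriesSolver
    b : ℕ
    b = n ∸ suc k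
    n∸k≡1+b : n ∸ k ≡.≡ suc b
    n∸k≡1+b = ℕₚ.+-∸-assoc 1 k<n

open SeriesRing
open Monomials using (q^-zero; q^-+)
open Inverses using (ConstantTermOne)
open Division using (divide)
open GaussianBinomials using (qbinom-vanish; qbinom-ratio)
open import Data.Nat using (ℕ; zero; suc; _∸_; _≤_; _<_; _+_; _*_; z≤n)
import Data.Nat.Properties as ℕₚ
open import Data.Nat.Combinatorics using (_C_; nC1≡n; nCk+nC[k+1]≡[n+1]C[k+1])
open import Algebra.Bundles using (CommutativeRing)
open CommutativeRing seriesRing
  using (setoid; refl; sym; trans; *-cong; *-congˡ; *-congʳ; *-assoc; *-identityˡ;
         zeroʳ; distribˡ; +-cong; +-congˡ; +-congʳ; -‿cong)
open import Relation.Binary.Reasoning.Setoid setoid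
import Relation.Binary.PropositionalEquality as ≡

-- Σ_{j<k} F j, computed coefficientwise; sumS 1 d F is definitionally Σ_{j<d} F (j+1)
sumSeries : (ℕ → Series) → ℕ → Series
sumSeries F k n = sumBelow (λ j → F j n) k

sumSeries-cong : ∀ {F G} k → (∀ j → j < k → F j ≋ G j) → sumSeries F k ≋ sumSeries G k
sumSeries-cong k F≋G = coeffwise (λ n → FiniteSums.sum-cong k (λ j j<k → coeffs (F≋G j j<k) n))

sumSeries-scale : ∀ c F k → c ⊛ sumSeries F k ≋ sumSeries (λ j → c ⊛ F j) k
sumSeries-scale c F zero    = trans (*-congˡ {c} (coeffwise (λ n → ≡.sym (𝟘-coeff n))))
                                    (trans (zeroʳ c) (coeffwise 𝟘-coeff))
sumSeries-scale c F (suc k) = trans (distribˡ c (sumSeries F k) (F k))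
                                    (+-congʳ {c ⊛ F k} (sumSeries-scale c F k))

sumSeries-telescope : ∀ (U : ℕ → Series) k → sumSeries (λ j → U j ⊖ U (suc j)) k ≋ U 0 ⊖ U k
sumSeries-telescope U k = coeffwise (λ n → FiniteSums.sum-telescope (λ j → U j n) k)

twice : ∀ d → 2 * d ≡.≡ d + d
twice d = ≡.cong (d +_) (ℕₚ.+-identityʳ d)

central-gap : ∀ d m → 2 * d ∸ (d + m) ≡.≡ d ∸ m
central-gap d m = ≡.trans (≡.cong (_∸ (d + m)) (twice d)) (ℕₚ.[m+n]∸[m+o]≡n∸o d d m)

C2-suc : ∀ m → suc m C 2 ≡.≡ m C 2 + m
C2-suc m = ≡.trans (≡.sym (nCk+nC[k+1]≡[n+1]C[k+1] m 1))
                   (≡.trans (≡.cong (_+ m C 2) (nC1≡n m)) (ℕₚ.+-comm m (m C 2)))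

G : ℕ → ℕ → Series
G d m = q^ (m C 2) ⊛ (𝟙 ⊖ q^ m) ⊛ qbinom (2 * d) (d + m)

T : ℕ → ℕ → Series
T d m = q^ (m C 2) ⊛ (𝟙 ⊖ q^ (d + m)) ⊛ qbinom (2 * d) (d + m)

T-suc : ∀ d m → m ≤ d →
        T d (suc m) ≋ (q^ (m C 2) ⊛ q^ m) ⊛ ((𝟙 ⊖ q^ (d ∸ m)) ⊛ qbinom (2 * d) (d + m))
T-suc d m m≤d = begin
  q^ (suc m C 2) ⊛ (𝟙 ⊖ q^ (d + suc m)) ⊛ qbinom (2 * d) (d + suc m)
    ≈⟨ *-assoc (q^ (suc m C 2)) (𝟙 ⊖ q^ (d + suc m)) (qbinom (2 * d) (d + suc m)) ⟩
  q^ (suc m C 2) ⊛ ((𝟙 ⊖ q^ (d + suc m)) ⊛ qbinom (2 * d) (d + suc m))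
    ≈⟨ ≡⇒≋ (≡.cong₂ (λ c k → q^ c ⊛ ((𝟙 ⊖ q^ k) ⊛ qbinom (2 * d) k))
                    (C2-suc m) (ℕₚ.+-suc d m)) ⟩
  q^ (m C 2 + m) ⊛ ((𝟙 ⊖ q^ (suc (d + m))) ⊛ qbinom (2 * d) (suc (d + m)))
    ≈⟨ *-cong (sym (q^-+ (m C 2) m)) (qbinom-ratio (2 * d) (d + m) d+m≤2d) ⟩
  (q^ (m C 2) ⊛ q^ m) ⊛ ((𝟙 ⊖ q^ (2 * d ∸ (d + m))) ⊛ qbinom (2 * d) (d + m))
    ≈⟨ ≡⇒≋ (≡.cong (λ k → (q^ (m C 2) ⊛ q^ m) ⊛ ((𝟙 ⊖ q^ k) ⊛ qbinom (2 * d) (d + m)))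
                   (central-gap d m)) ⟩
  (q^ (m C 2) ⊛ q^ m) ⊛ ((𝟙 ⊖ q^ (d ∸ m)) ⊛ qbinom (2 * d) (d + m)) ∎
  where
  d+m≤2d : d + m ≤ 2 * d
  d+m≤2d = ≡.subst (d + m ≤_) (≡.sym (twice d)) (ℕₚ.+-monoʳ-≤ d m≤d)

summand-telescopes : ∀ d m → m ≤ d → (𝟙 ⊕ q^ d) ⊛ G d m ≋ T d m ⊖ T d (suc m)
summand-telescopes d m m≤d = begin
  (𝟙 ⊕ q^ d) ⊛ (Q ⊛ (𝟙 ⊖ Y) ⊛ B)
    ≈⟨ *-congʳ {Q ⊛ (𝟙 ⊖ Y) ⊛ B} (+-congˡ {𝟙} (sym YZ≋q^d)) ⟩
  (𝟙 ⊕ Y ⊛ Z) ⊛ (Q ⊛ (𝟙 ⊖ Y) ⊛ B)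
    ≈⟨ solve 4 (λ Y Z Q B → (con 1ℤ :+ Y :* Z) :* (Q :* (con 1ℤ :- Y) :* B)
                          := Q :* (con 1ℤ :- Y :* Z :* Y) :* B :- (Q :* Y) :* ((con 1ℤ :- Z) :* B))
               refl Y Z Q B ⟩
  Q ⊛ (𝟙 ⊖ Y ⊛ Z ⊛ Y) ⊛ B ⊖ (Q ⊛ Y) ⊛ ((𝟙 ⊖ Z) ⊛ B)
    ≈⟨ +-cong (*-congʳ {B} (*-congˡ {Q} (+-congˡ {𝟙} (-‿cong YZY≋q^[d+m]))))
              (-‿cong (sym (T-suc d m m≤d))) ⟩
  T d m ⊖ T d (suc m) ∎
  where
  open SeriesSolver
  open import Data.Integer using (1ℤ)
  Q Y Z B : Series
  Q = q^ (m C 2)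
  Y = q^ m
  Z = q^ (d ∸ m)
  B = qbinom (2 * d) (d + m)
  YZ≋q^d : Y ⊛ Z ≋ q^ d
  YZ≋q^d = trans (q^-+ m (d ∸ m)) (≡⇒≋ (≡.cong q^ (ℕₚ.m+[n∸m]≡n m≤d)))
  YZY≋q^[d+m] : Y ⊛ Z ⊛ Y ≋ q^ (d + m)
  YZY≋q^[d+m] = trans (*-congʳ {Y} YZ≋q^d) (q^-+ d m)

T-first : ∀ d → T d 1 ≋ (𝟙 ⊖ q^ d) ⊛ qbinom (2 * d) d
T-first d = begin
  T d 1
    ≈⟨ T-suc d 0 z≤n ⟩
  (q^ 0 ⊛ q^ 0) ⊛ ((𝟙 ⊖ q^ d) ⊛ qbinom (2 * d) (d + 0))
    ≈⟨ *-cong (trans (q^-+ 0 0) q^-zero)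
              (≡⇒≋ (≡.cong (λ k → (𝟙 ⊖ q^ d) ⊛ qbinom (2 * d) k) (ℕₚ.+-identityʳ d))) ⟩
  𝟙 ⊛ ((𝟙 ⊖ q^ d) ⊛ qbinom (2 * d) d)
    ≈⟨ *-identityˡ ((𝟙 ⊖ q^ d) ⊛ qbinom (2 * d) d) ⟩
  (𝟙 ⊖ q^ d) ⊛ qbinom (2 * d) d ∎

T-last : ∀ d → T d (suc d) ≋ 𝟘
T-last d = trans (*-congˡ {c} (qbinom-vanish (2 * d) (d + suc d) 2d<d+[1+d])) (zeroʳ c)
  where
  c : Series
  c = q^ (suc d C 2) ⊛ (𝟙 ⊖ q^ (d + suc d))
  2d<d+[1+d] : 2 * d < d + suc d
  2d<d+[1+d] = ≡.subst₂ _<_ (≡.sym (twice d)) (≡.sym (ℕₚ.+-suc d d)) ℕₚ.≤-refl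

scaled-sum : ∀ d → (𝟙 ⊕ q^ d) ⊛ sumS 1 d (G d) ≋ (𝟙 ⊖ q^ d) ⊛ qbinom (2 * d) d
scaled-sum d = begin
  (𝟙 ⊕ q^ d) ⊛ sumSeries (λ j → G d (suc j)) d
    ≈⟨ sumSeries-scale (𝟙 ⊕ q^ d) (λ j → G d (suc j)) d ⟩
  sumSeries (λ j → (𝟙 ⊕ q^ d) ⊛ G d (suc j)) d
    ≈⟨ sumSeries-cong d (λ j j<d → summand-telescopes d (suc j) j<d) ⟩
  sumSeries (λ j → T d (suc j) ⊖ T d (suc (suc j))) d
    ≈⟨ sumSeries-telescope (λ j → T d (suc j)) d ⟩
  T d 1 ⊖ T d (suc d)
    ≈⟨ +-congˡ {T d 1} (-‿cong (T-last d)) ⟩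
  T d 1 ⊖ 𝟘
    ≈⟨ solve 1 (λ t → t :- con 0ℤ := t) refl (T d 1) ⟩
  T d 1
    ≈⟨ T-first d ⟩
  (𝟙 ⊖ q^ d) ⊛ qbinom (2 * d) d ∎
  where
  open SeriesSolver
  open import Data.Integer using (0ℤ)

one-plus-q^-constantTermOne : ∀ d → 1 ≤ d → ConstantTermOne (𝟙 ⊕ q^ d)
one-plus-q^-constantTermOne (suc d) _ = ≡.refl

corollary1p5 : (d : ℕ) → 1 ≤ d →
    sumS 1 d (λ m → q^ (m C 2) ⊛ (𝟙 ⊖ q^ m) ⊛ qbinom (2 * d) (d + m))
    ≈ (𝟙 ⊖ q^ d) ⊛ inv (𝟙 ⊕ q^ d) ⊛ qbinom (2 * d) d
corollary1p5 d 1≤d = coeffs (begin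
  sumS 1 d (G d)
    ≈⟨ divide (𝟙 ⊕ q^ d) (one-plus-q^-constantTermOne d 1≤d) (scaled-sum d) ⟩
  inv (𝟙 ⊕ q^ d) ⊛ ((𝟙 ⊖ q^ d) ⊛ qbinom (2 * d) d)
    ≈⟨ solve 3 (λ i a b → i :* (a :* b) := a :* i :* b) refl
               (inv (𝟙 ⊕ q^ d)) (𝟙 ⊖ q^ d) (qbinom (2 * d) d) ⟩
  (𝟙 ⊖ q^ d) ⊛ inv (𝟙 ⊕ q^ d) ⊛ qbinom (2 * d) d ∎)
  where open SeriesSolver
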